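{- Let $k\ge2$ be an integer, let $q\in\mathbb N$ and suppose that $d\mid q$. Let $e_0$ be a divisor of $d$, and write $d/e_0=d_1d_2^2\cdots d_k^k$, where $d_1,\dots,d_{k-1}$ are pairwise coprime and squarefree. Then \[ \kappa(q/d)\le k^{4\omega(q)}\kappa(q)e_0d_1\cdots d_k. \]
   Context: $\kappa(q)=\kappa_k(q)$ is the multiplicative function defined on prime powers by $\kappa(p^{uk+v})=kp^{ -u-1/2}$ when $u\ge0$ and $v=1$, and $\kappa(p^{uk+v})=p^{ -u-1}$ when $u\ge0$ and $2\le v\le k$ (so $\kappa(1)=1$). $\omega(q)$ denotes the number of distinct prime divisors of $q$. -}

module Defs where

open import Data.Nat as ℕ using (ℕ; zero; suc; _+_; _*_; _∸_; _^_; NonZero)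
open import Data.Nat.Properties using (m^n≢0)
open import Data.Nat.DivMod using (_/_; _%_)
open import Data.Nat.Divisibility using (_∣_; _∣?_)
open import Data.Nat.Primality using (Prime; prime?)
open import Data.Integer using (+_)
open import Data.Rational as ℚ using (ℚ)
open import Data.List using (List; filter; upTo; foldr; length)
open import Data.Fin using (Fin; toℕ)
open import Data.Fin as Fin using ()
open import Relation.Nullary.Decidable using (_×-dec_; yes; no)

-- p-adic valuation v_p(n) (meaningful for p ≥ 2, n ≥ 1); computed with fuel n
valAux : ℕ → (p n : ℕ) → .{{NonZero p}} → ℕ
valAux zero    p n = 0
valAux (suc f) p n with p ∣? n
... | yes _ = suc (valAux f p (n / p))
... | no  _ = 0

val : (p n : ℕ) → .{{NonZero p}} → ℕ
val p n = valAux n p n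

primeDivisors : ℕ → List ℕ
primeDivisors q = filter (λ p → prime? p ×-dec p ∣? q) (upTo (suc q))

ω : ℕ → ℕ
ω q = length (primeDivisors q)

-- SQUARE of the local factor κ_k(p^e), e ≥ 1, with e = u k + v, 1 ≤ v ≤ k:
--   κ(p^(uk+1))² = k² p^(-(2u+1)),   κ(p^(uk+v))² = p^(-(2u+2)) for 2 ≤ v ≤ k;
--   κ(p^0)² = 1.
κsqLocal : (k p e : ℕ) → ℚ
κsqLocal k zero    e     = ℚ.1ℚ   -- p = 0 never occurs
κsqLocal k (suc p) zero  = ℚ.1ℚ
κsqLocal k (suc p) (suc e) = local (e / suc k′) (e % suc k′)
  where
    -- k ≥ 2 in all uses; k′ + 1 = k for k ≥ 1
    k′ = k ∸ 1
    local : ℕ → ℕ → ℚ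
    local u zero    = ℚ._/_ (+ (k * k)) (suc p ^ (2 * u + 1)) {{m^n≢0 (suc p) (2 * u + 1)}}
    local u (suc _) = ℚ._/_ (+ 1) (suc p ^ (2 * u + 2)) {{m^n≢0 (suc p) (2 * u + 2)}}

κsq : (k q : ℕ) → ℚ
κsq k q = foldr (λ p acc → κsqLocal k p (valP p) ℚ.* acc) ℚ.1ℚ (primeDivisors q)
  where
    valP : ℕ → ℕ
    valP zero    = 0
    valP (suc p) = val (suc p) q

prodFin : (n : ℕ) → (Fin n → ℕ) → ℕ
prodFin zero    f = 1
prodFin (suc n) f = f Fin.zero * prodFin n (λ i → f (Fin.suc i))

Squarefree : ℕ → Set
Squarefree n = ∀ m → m * m ∣ n → m ≡ 1
  where open import Relation.Binary.PropositionalEquality using (_≡_)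

-- Both sides are products over the primes p ∣ q of local factors. Write κ(p^e)² = N(e) / p^s(e) with
-- N(e) ∈ {1, k²}: the exponent s is nondecreasing and s(e + k) = s(e) + 2. Put M = e₀ d₁ ⋯ d_k. Since
-- M ∣ d ∣ M^k, v_p(d) ≤ k v_p(M), so s(v_p q) ≤ s(v_p(q/d)) + 2 v_p(M) and therefore
-- κ(p^{v_p(q/d)})² ≤ k² p^{2 v_p(M)} κ(p^{v_p q})². Taking the product over p ∣ q, the p^{v_p(M)} multiply
-- to a divisor of M and the k² to k^{2ω(q)} ≤ k^{8ω(q)}.
module Submission where

open import Defs
open import Algebra.Bundles using (CommutativeMonoid)
import Algebra.Properties.CommutativeSemigroup as CommutativeSemigroupProperties
open import Data.Fin.Base as Fin using (Fin; toℕ)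
open import Data.Fin.Properties using (toℕ<n)
open import Data.Integer.Base using (+_)
import Data.Integer.Base as ℤ using (_≤_; _*_; +≤+)
import Data.Integer.Properties as ℤ using (pos-*)
open import Data.List.Base using (List; []; _∷_; [_]; _++_; map; foldr; filter; upTo; length)
open import Data.List.Properties
  using (map-cong-local; foldr-cong; upTo-∷ʳ; filter-++; filter-reject; ++-identityʳ)
open import Data.List.Relation.Unary.All as All using (All; []; _∷_)
open import Data.List.Relation.Unary.All.Properties using (all-filter)
open import Data.List.Relation.Unary.AllPairs using ([]; _∷_)
open import Data.List.Relation.Unary.Unique.Propositional using (Unique)
import Data.List.Relation.Unary.Unique.Propositional.Properties as Unique
open import Data.Nat.Base
  using (ℕ; zero; suc; _+_; _*_; _^_; _∸_; _≤_; _<_; _≤′_; ≤′-refl; ≤′-step; z≤n; s≤s;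
         NonZero; >-nonZero; ≢-nonZero; ≢-nonZero⁻¹; nonTrivial⇒n>1)
open import Data.Nat.Coprimality using (Coprime)
open import Data.Nat.DivMod
  using (_/_; _%_; m≡m%n+[m/n]*n; m%n<n; m<n⇒m%n≡m; [m+kn]%n≡m%n; m<n⇒m/n≡0; m*n/n≡m;
         +-distrib-/-∣ʳ; m*[n/m]≡n; m/n<m; m≥n⇒m/n>0)
open import Data.Nat.Divisibility
open import Data.Nat.ListAction using (product)
open import Data.Nat.Primality
  using (Prime; prime?; prime⇒nonZero; prime⇒nonTrivial; prime⇒irreducible; euclidsLemma)
open import Data.Nat.Properties
open import Data.Nat.Tactic.RingSolver using (solve-∀)
open import Data.Product.Base using (∃-syntax; _×_; _,_; proj₁)
open import Data.Rational.Base using (ℚ; NonNegative; nonNegative; 1ℚ; toℚᵘ)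
  renaming (_≤_ to _≤ℚ_; _*_ to _*ℚ_; _/_ to _/ℚ_)
import Data.Rational.Properties as ℚ
import Data.Rational.Unnormalised.Base as ℚᵘ using (mkℚᵘ; _≃_; _*_; *≤*; *≡*)
import Data.Rational.Unnormalised.Properties as ℚᵘ
  using (≃-sym; ≤-respˡ-≃; ≤-respʳ-≃; *-cong; module ≃-Reasoning)
open import Data.Sum.Base using (inj₁; inj₂)
open import Function.Base using (_∘_; it)
open import Level using (0ℓ)
open import Relation.Binary.PropositionalEquality hiding ([_])
open import Relation.Nullary using (¬_; yes; no; contradiction)
open import Relation.Nullary.Decidable using (_×-dec_)
open import Relation.Unary using (Pred; Decidable)

module ℕ* = CommutativeSemigroupProperties *-commutativeSemigroup
module ℚ* =
  CommutativeSemigroupProperties (CommutativeMonoid.commutativeSemigroup ℚ.*-1-commutativeMonoid)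

variable
  a b g k m n p : ℕ

-- p-adic valuations

prime⇒>1 : Prime p → 1 < p
prime⇒>1 {p} pp = nonTrivial⇒n>1 p {{prime⇒nonTrivial pp}}

¬∣⇒nonZero : ¬ p ∣ n → NonZero n
¬∣⇒nonZero {p} {zero}  p∤0 = contradiction (p ∣0) p∤0
¬∣⇒nonZero {n = suc n} _   = _

valAux-none : .{{_ : NonZero p}} → ∀ f → ¬ p ∣ n → valAux f p n ≡ 0
valAux-none zero _ = refl
valAux-none {p} {n} (suc f) p∤n with p ∣? n
... | yes p∣n = contradiction p∣n p∤n
... | no  _   = refl

val-none : .{{_ : NonZero p}} → ¬ p ∣ n → val p n ≡ 0
val-none {n = n} = valAux-none n

valAux-split : .{{_ : NonZero p}} → 1 < p → ∀ f n → .{{NonZero n}} → n ≤ f →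
               ∃[ m ] ¬ p ∣ m × n ≡ p ^ valAux f p n * m
valAux-split 1<p zero (suc n) ()
valAux-split {p} 1<p (suc f) n n≤f with p ∣? n
... | no p∤n = n , p∤n , sym (*-identityˡ n)
... | yes p∣n with valAux-split 1<p f (n / p) {{>-nonZero (m≥n⇒m/n>0 (∣⇒≤ p∣n))}}
                                 (≤-pred (<-≤-trans (m/n<m n p 1<p) n≤f))
...   | m , p∤m , n/p≡ = m , p∤m , (begin
  n                                ≡⟨ m*[n/m]≡n p∣n ⟨
  p * (n / p)                      ≡⟨ cong (p *_) n/p≡ ⟩
  p * (p ^ valAux f p (n / p) * m) ≡⟨ *-assoc p _ m ⟨
  p ^ suc (valAux f p (n / p)) * m ∎)
  where open ≡-Reasoning

val-split : .{{_ : NonZero p}} → 1 < p → ∀ n → .{{NonZero n}} →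
            ∃[ m ] ¬ p ∣ m × n ≡ p ^ val p n * m
val-split 1<p n = valAux-split 1<p n n ≤-refl

p^a*m≡p^b*n⇒a≡b : .{{_ : NonZero p}} → ¬ p ∣ m → ¬ p ∣ n → p ^ a * m ≡ p ^ b * n → a ≡ b
p^a*m≡p^b*n⇒a≡b {a = zero} {b = zero} _ _ _ = refl
p^a*m≡p^b*n⇒a≡b {p} {m} {n} {zero} {suc b} p∤m _ eq =
  contradiction (subst (p ∣_) (trans (sym eq) (*-identityˡ m)) (∣m⇒∣m*n n (m∣m*n (p ^ b)))) p∤m
p^a*m≡p^b*n⇒a≡b {p} {m} {n} {suc a} {zero} _ p∤n eq =
  contradiction (subst (p ∣_) (trans eq (*-identityˡ n)) (∣m⇒∣m*n m (m∣m*n (p ^ a)))) p∤n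
p^a*m≡p^b*n⇒a≡b {p} {m} {n} {suc a} {suc b} p∤m p∤n eq =
  cong suc (p^a*m≡p^b*n⇒a≡b p∤m p∤n
    (*-cancelˡ-≡ _ _ p (trans (sym (*-assoc p _ m)) (trans eq (*-assoc p _ n)))))

val-p^a*m : .{{_ : NonZero p}} → 1 < p → ¬ p ∣ m → val p (p ^ a * m) ≡ a
val-p^a*m {p} {m} {a} 1<p p∤m
  with m′ , p∤m′ , eq ← val-split 1<p (p ^ a * m) {{m*n≢0 _ _ {{m^n≢0 p a}} {{¬∣⇒nonZero p∤m}}}} =
  sym (p^a*m≡p^b*n⇒a≡b p∤m p∤m′ eq)

val-* : .{{_ : NonZero p}} → Prime p → ∀ m n → .{{NonZero m}} → .{{NonZero n}} →
        val p (m * n) ≡ val p m + val p n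
val-* {p} pp m n
  with m′ , p∤m′ , m≡ ← val-split (prime⇒>1 pp) m
     | n′ , p∤n′ , n≡ ← val-split (prime⇒>1 pp) n = begin
  val p (m * n)                       ≡⟨ cong (λ x → val p x) (cong₂ _*_ m≡ n≡) ⟩
  val p ((p ^ i * m′) * (p ^ j * n′)) ≡⟨ cong (λ x → val p x) (ℕ*.interchange (p ^ i) m′ (p ^ j) n′) ⟩
  val p ((p ^ i * p ^ j) * (m′ * n′)) ≡⟨ cong (λ x → val p (x * (m′ * n′))) (^-distribˡ-+-* p i j) ⟨
  val p (p ^ (i + j) * (m′ * n′))     ≡⟨ val-p^a*m (prime⇒>1 pp) p∤m′n′ ⟩
  i + j                               ∎
  where
  open ≡-Reasoning
  i = val p m
  j = val p n
  p∤m′n′ : ¬ p ∣ m′ * n′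
  p∤m′n′ p∣m′n′ with euclidsLemma m′ n′ pp p∣m′n′
  ... | inj₁ p∣m′ = p∤m′ p∣m′
  ... | inj₂ p∣n′ = p∤n′ p∣n′

val-1 : .{{_ : NonZero p}} → 1 < p → val p 1 ≡ 0
val-1 1<p = val-none (λ p∣1 → <⇒≢ 1<p (sym (∣1⇒≡1 p∣1)))

val-^ : .{{_ : NonZero p}} → Prime p → ∀ m e → .{{NonZero m}} → val p (m ^ e) ≡ e * val p m
val-^ pp m zero = val-1 (prime⇒>1 pp)
val-^ {p} pp m (suc e) =
  trans (val-* pp m (m ^ e) {{it}} {{m^n≢0 m e}}) (cong (_+_ (val p m)) (val-^ pp m e))

val-mono-∣ : .{{_ : NonZero p}} → Prime p → .{{NonZero n}} → m ∣ n → val p m ≤ val p n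
val-mono-∣ {p} {m = m} pp (divides c refl) = begin
  val p m           ≤⟨ m≤n+m (val p m) (val p c) ⟩
  val p c + val p m ≡⟨ val-* pp c m {{m*n≢0⇒m≢0 c}} {{m*n≢0⇒n≢0 c}} ⟨
  val p (c * m)     ∎
  where open ≤-Reasoning

val-r^a*m : ∀ {r} .{{_ : NonZero p}} → Prime p → Prime r → p ≢ r → ∀ a m → .{{NonZero m}} →
            val p (r ^ a * m) ≡ val p m
val-r^a*m {p} {r} pp pr p≢r a m = begin
  val p (r ^ a * m)       ≡⟨ val-* pp (r ^ a) m {{m^n≢0 r a {{prime⇒nonZero pr}}}} ⟩
  val p (r ^ a) + val p m ≡⟨ cong (_+ val p m) (val-^ pp r a {{prime⇒nonZero pr}}) ⟩
  a * val p r + val p m   ≡⟨ cong (λ v → a * v + val p m) (val-none p∤r) ⟩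
  a * 0 + val p m         ≡⟨ cong (_+ val p m) (*-zeroʳ a) ⟩
  val p m                 ∎
  where
  open ≡-Reasoning
  p∤r : ¬ p ∣ r
  p∤r p∣r with prime⇒irreducible pr p∣r
  ... | inj₁ p≡1 = <⇒≢ (prime⇒>1 pp) (sym p≡1)
  ... | inj₂ p≡r = p≢r p≡r

-- As inside κsq, the junk value at p = 0 is 0.
valuation : ℕ → ℕ → ℕ
valuation zero    n = 0
valuation (suc p) n = val (suc p) n

primePowerPart : List ℕ → ℕ → ℕ
primePowerPart ps n = product (map (λ p → p ^ valuation p n) ps)

primePowerPart-∣ : ∀ {ps} → All Prime ps → Unique ps → ∀ n → .{{NonZero n}} →
                   primePowerPart ps n ∣ n
primePowerPart-∣ [] [] n = 1∣ n
primePowerPart-∣ {zero ∷ _} (() ∷ _) _ n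
primePowerPart-∣ {suc p ∷ ps} (pp ∷ pps) (p∉ps ∷ ps-unique) n
  with m , p∤m , n≡ ← val-split (prime⇒>1 pp) n =
  subst₂ _∣_ (cong (λ t → suc p ^ v * product t) (map-cong-local (same-valuations pps p∉ps)))
             (sym n≡)
             (*-monoʳ-∣ (suc p ^ v) (primePowerPart-∣ pps ps-unique m {{¬∣⇒nonZero p∤m}}))
  where
  v = val (suc p) n
  same-valuations : ∀ {rs} → All Prime rs → All (suc p ≢_) rs →
                    All (λ r → r ^ valuation r m ≡ r ^ valuation r n) rs
  same-valuations [] [] = []
  same-valuations {zero ∷ _} (() ∷ _) _
  same-valuations {suc r ∷ _} (pr ∷ prs) (p≢r ∷ p≢rs) =
    cong (suc r ^_) (sym (trans (cong (λ x → val (suc r) x) n≡)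
                                (val-r^a*m pr pp (p≢r ∘ sym) v m {{¬∣⇒nonZero p∤m}})))
      ∷ same-valuations prs p≢rs

toℚᵘ-fraction : ∀ a b → toℚᵘ (+ a /ℚ suc b) ℚᵘ.≃ ℚᵘ.mkℚᵘ (+ a) b
toℚᵘ-fraction a b = ℚ.toℚᵘ-fromℚᵘ (ℚᵘ.mkℚᵘ (+ a) b)

fraction-≤ : ∀ a b c d .{{_ : NonZero b}} .{{_ : NonZero d}} → a * d ≤ c * b → + a /ℚ b ≤ℚ + c /ℚ d
fraction-≤ a (suc b) c (suc d) ad≤cb = ℚ.toℚᵘ-cancel-≤
  (ℚᵘ.≤-respʳ-≃ (ℚᵘ.≃-sym (toℚᵘ-fraction c d)) (ℚᵘ.≤-respˡ-≃ (ℚᵘ.≃-sym (toℚᵘ-fraction a b))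
    (ℚᵘ.*≤* (subst₂ ℤ._≤_ (ℤ.pos-* a (suc d)) (ℤ.pos-* c (suc b)) (ℤ.+≤+ ad≤cb)))))

fraction-* : ∀ a b c d .{{_ : NonZero b}} .{{_ : NonZero d}} →
             (+ a /ℚ b) *ℚ (+ c /ℚ d) ≡ (+ (a * c) /ℚ (b * d)) {{m*n≢0 b d}}
fraction-* a (suc b) c (suc d) = ℚ.toℚᵘ-injective (begin
  toℚᵘ ((+ a /ℚ suc b) *ℚ (+ c /ℚ suc d))         ≈⟨ ℚ.toℚᵘ-homo-* (+ a /ℚ suc b) (+ c /ℚ suc d) ⟩
  toℚᵘ (+ a /ℚ suc b) ℚᵘ.* toℚᵘ (+ c /ℚ suc d)    ≈⟨ ℚᵘ.*-cong (toℚᵘ-fraction a b) (toℚᵘ-fraction c d) ⟩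
  ℚᵘ.mkℚᵘ (+ a) b ℚᵘ.* ℚᵘ.mkℚᵘ (+ c) d            ≈⟨ ℚᵘ.*≡* (cong (ℤ._* + suc (d + b * suc d)) (sym (ℤ.pos-* a c))) ⟩
  ℚᵘ.mkℚᵘ (+ (a * c)) (d + b * suc d)             ≈⟨ toℚᵘ-fraction (a * c) (d + b * suc d) ⟨
  toℚᵘ (+ (a * c) /ℚ (suc b * suc d))             ∎)
  where open ℚᵘ.≃-Reasoning

fraction-square-scale-≤ : ∀ u a b (x : ℚ) → .{{NonNegative x}} → u ≤ a * b →
                          (+ (u * u) /ℚ 1) *ℚ x ≤ℚ ((+ (a * a) /ℚ 1) *ℚ x) *ℚ (+ (b * b) /ℚ 1)
fraction-square-scale-≤ u a b x u≤ab = begin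
  (+ (u * u) /ℚ 1) *ℚ x                          ≤⟨ ℚ.*-monoʳ-≤-nonNeg x u²≤[ab]² ⟩
  (+ ((a * b) * (a * b)) /ℚ 1) *ℚ x              ≡⟨ cong (λ n → (+ n /ℚ 1) *ℚ x) (ℕ*.interchange a b a b) ⟩
  (+ ((a * a) * (b * b)) /ℚ 1) *ℚ x              ≡⟨ cong (_*ℚ x) (fraction-* (a * a) 1 (b * b) 1) ⟨
  ((+ (a * a) /ℚ 1) *ℚ (+ (b * b) /ℚ 1)) *ℚ x    ≡⟨ ℚ*.xy∙z≈xz∙y (+ (a * a) /ℚ 1) (+ (b * b) /ℚ 1) x ⟩
  ((+ (a * a) /ℚ 1) *ℚ x) *ℚ (+ (b * b) /ℚ 1)    ∎
  where
  open ℚ.≤-Reasoning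
  u²≤[ab]² : + (u * u) /ℚ 1 ≤ℚ + ((a * b) * (a * b)) /ℚ 1
  u²≤[ab]² = fraction-≤ (u * u) 1 ((a * b) * (a * b)) 1 (*-monoˡ-≤ 1 (*-mono-≤ u≤ab u≤ab))

product-map-* : ∀ (f g : ℕ → ℕ) xs →
                product (map (λ x → f x * g x) xs) ≡ product (map f xs) * product (map g xs)
product-map-* f g []       = refl
product-map-* f g (x ∷ xs) = trans (cong (f x * g x *_) (product-map-* f g xs))
                                   (ℕ*.interchange (f x) (g x) (product (map f xs)) (product (map g xs)))

product-map-const : ∀ c (xs : List ℕ) → product (map (λ _ → c) xs) ≡ c ^ length xs
product-map-const c []       = refl
product-map-const c (x ∷ xs) = cong (c *_) (product-map-const c xs)

prodℚ : List ℕ → (ℕ → ℚ) → ℚ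
prodℚ ps f = foldr (λ p acc → f p *ℚ acc) 1ℚ ps

prodℚ-nonNeg : ∀ {f : ℕ → ℚ} xs → (∀ x → NonNegative (f x)) → NonNegative (prodℚ xs f)
prodℚ-nonNeg []           _   = _
prodℚ-nonNeg {f} (x ∷ xs) f≥0 =
  ℚ.nonNeg*nonNeg⇒nonNeg (f x) {{f≥0 x}} (prodℚ xs f) {{prodℚ-nonNeg {f} xs f≥0}}

prodℚ-mono : ∀ {f g : ℕ → ℚ} {xs} → (∀ x → NonNegative (f x)) → All (λ x → f x ≤ℚ g x) xs →
             prodℚ xs f ≤ℚ prodℚ xs g
prodℚ-mono f≥0 [] = ℚ.≤-refl
prodℚ-mono {f} {g} {x ∷ xs} f≥0 (fx≤gx ∷ f≤g) = ℚ.≤-trans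
  (ℚ.*-monoʳ-≤-nonNeg (prodℚ xs f) {{prodℚ-nonNeg {f} xs f≥0}} fx≤gx)
  (ℚ.*-monoˡ-≤-nonNeg (g x) {{gx≥0}} (prodℚ-mono f≥0 f≤g))
  where
  gx≥0 : NonNegative (g x)
  gx≥0 = nonNegative (ℚ.≤-trans (ℚ.nonNegative⁻¹ (f x) {{f≥0 x}}) fx≤gx)

prodℚ-scale : ∀ (h : ℕ → ℕ) (f : ℕ → ℚ) xs →
              prodℚ xs (λ x → (+ h x /ℚ 1) *ℚ f x) ≡ (+ product (map h xs) /ℚ 1) *ℚ prodℚ xs f
prodℚ-scale h f []       = refl
prodℚ-scale h f (x ∷ xs) = begin
  ((+ h x /ℚ 1) *ℚ f x) *ℚ prodℚ xs (λ x → (+ h x /ℚ 1) *ℚ f x)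
    ≡⟨ cong (((+ h x /ℚ 1) *ℚ f x) *ℚ_) (prodℚ-scale h f xs) ⟩
  ((+ h x /ℚ 1) *ℚ f x) *ℚ ((+ H /ℚ 1) *ℚ prodℚ xs f)
    ≡⟨ ℚ*.interchange (+ h x /ℚ 1) (f x) (+ H /ℚ 1) (prodℚ xs f) ⟩
  ((+ h x /ℚ 1) *ℚ (+ H /ℚ 1)) *ℚ (f x *ℚ prodℚ xs f)
    ≡⟨ cong (_*ℚ (f x *ℚ prodℚ xs f)) (fraction-* (h x) 1 H 1) ⟩
  (+ (h x * H) /ℚ 1) *ℚ (f x *ℚ prodℚ xs f) ∎
  where
  open ≡-Reasoning
  H = product (map h xs)

prodℚ-filter-× : ∀ {P Q : Pred ℕ 0ℓ} (P? : Decidable P) (Q? : Decidable Q) {f : ℕ → ℚ} →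
                 (∀ x → P x → ¬ Q x → f x ≡ 1ℚ) → ∀ xs →
                 prodℚ (filter (λ x → P? x ×-dec Q? x) xs) f ≡ prodℚ (filter P? xs) f
prodℚ-filter-× P? Q? f≡1 [] = refl
prodℚ-filter-× P? Q? {f} f≡1 (x ∷ xs) with P? x | Q? x
... | yes _  | yes _  = cong (f x *ℚ_) (prodℚ-filter-× P? Q? f≡1 xs)
... | yes Px | no ¬Qx = begin
  prodℚ (filter _ xs) f         ≡⟨ prodℚ-filter-× P? Q? f≡1 xs ⟩
  prodℚ (filter P? xs) f        ≡⟨ ℚ.*-identityˡ _ ⟨
  1ℚ *ℚ prodℚ (filter P? xs) f  ≡⟨ cong (_*ℚ prodℚ (filter P? xs) f) (f≡1 x Px ¬Qx) ⟨
  f x *ℚ prodℚ (filter P? xs) f ∎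
  where open ≡-Reasoning
... | no _   | _      = prodℚ-filter-× P? Q? f≡1 xs

filter-upTo-stable : ∀ {P : Pred ℕ 0ℓ} (P? : Decidable P) {m n} → m ≤ n →
                     (∀ {i} → m ≤ i → i < n → ¬ P i) → filter P? (upTo n) ≡ filter P? (upTo m)
filter-upTo-stable {P} P? {m} m≤n ¬P = go (≤⇒≤′ m≤n) ¬P
  where
  open ≡-Reasoning
  go : ∀ {n} → m ≤′ n → (∀ {i} → m ≤ i → i < n → ¬ P i) →
       filter P? (upTo n) ≡ filter P? (upTo m)
  go ≤′-refl _ = refl
  go {suc n} (≤′-step m≤′n) ¬P = begin
    filter P? (upTo (suc n))              ≡⟨ cong (filter P?) (upTo-∷ʳ n) ⟨
    filter P? (upTo n ++ [ n ])           ≡⟨ filter-++ P? (upTo n) [ n ] ⟩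
    filter P? (upTo n) ++ filter P? [ n ] ≡⟨ cong (filter P? (upTo n) ++_) (filter-reject P? ¬Pn) ⟩
    filter P? (upTo n) ++ []              ≡⟨ ++-identityʳ _ ⟩
    filter P? (upTo n)                    ≡⟨ go m≤′n (λ m≤i i<n → ¬P m≤i (m<n⇒m<1+n i<n)) ⟩
    filter P? (upTo m)                    ∎
    where ¬Pn = ¬P (≤′⇒≤ m≤′n) ≤-refl

-- The local factor κ(p^e)²

remainderExponent : ℕ → ℕ
remainderExponent zero    = 1
remainderExponent (suc _) = 2

remainderNumerator : ℕ → ℕ → ℕ
remainderNumerator k zero    = k * k
remainderNumerator k (suc _) = 1

κsqExponent : (k e : ℕ) → ℕ
κsqExponent k zero    = 0
κsqExponent k (suc e) = 2 * (e / suc (k ∸ 1)) + remainderExponent (e % suc (k ∸ 1))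

κsqNumerator : (k e : ℕ) → ℕ
κsqNumerator k zero    = 1
κsqNumerator k (suc e) = remainderNumerator k (e % suc (k ∸ 1))

κsqLocal≡ : ∀ k p e → κsqLocal k (suc p) e ≡
            (+ κsqNumerator k e /ℚ suc p ^ κsqExponent k e) {{m^n≢0 (suc p) (κsqExponent k e)}}
κsqLocal≡ k p zero    = refl
κsqLocal≡ k p (suc e) = byRemainder (e % suc (k ∸ 1)) refl
  where
  -- A `with` on e % suc (k ∸ 1) would also abstract it inside the normalised fraction: ill-typed.
  byRemainder : ∀ r → e % suc (k ∸ 1) ≡ r → κsqLocal k (suc p) (suc e) ≡
                (+ remainderNumerator k r /ℚ suc p ^ (2 * (e / suc (k ∸ 1)) + remainderExponent r))
                  {{m^n≢0 (suc p) (2 * (e / suc (k ∸ 1)) + remainderExponent r)}}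
  byRemainder zero    eq rewrite eq = refl
  byRemainder (suc _) eq rewrite eq = refl

1≤κsqNumerator : 1 ≤ k → ∀ e → 1 ≤ κsqNumerator k e
1≤κsqNumerator 1≤k zero = ≤-refl
1≤κsqNumerator {k} 1≤k (suc e) with e % suc (k ∸ 1)
... | zero  = *-mono-≤ 1≤k 1≤k
... | suc _ = ≤-refl

κsqNumerator≤k*k : 1 ≤ k → ∀ e → κsqNumerator k e ≤ k * k
κsqNumerator≤k*k 1≤k zero = *-mono-≤ 1≤k 1≤k
κsqNumerator≤k*k {k} 1≤k (suc e) with e % suc (k ∸ 1)
... | zero  = ≤-refl
... | suc _ = *-mono-≤ 1≤k 1≤k

remainderExponent≤2 : ∀ r → remainderExponent r ≤ 2
remainderExponent≤2 zero    = s≤s z≤n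
remainderExponent≤2 (suc _) = ≤-refl

κsqExponent-1+r+u*k : 1 ≤ k → ∀ u r → r < k → κsqExponent k (suc (r + u * k)) ≡ 2 * u + remainderExponent r
κsqExponent-1+r+u*k {suc k′} _ u r r<k = cong₂ (λ x y → 2 * x + remainderExponent y) quotient≡u remainder≡r
  where
  open ≡-Reasoning
  quotient≡u : (r + u * suc k′) / suc k′ ≡ u
  quotient≡u = begin
    (r + u * suc k′) / suc k′        ≡⟨ +-distrib-/-∣ʳ r (n∣m*n u) ⟩
    r / suc k′ + u * suc k′ / suc k′ ≡⟨ cong₂ _+_ (m<n⇒m/n≡0 r<k) (m*n/n≡m u (suc k′)) ⟩
    u                                ∎
  remainder≡r : (r + u * suc k′) % suc k′ ≡ r
  remainder≡r = trans ([m+kn]%n≡m%n r u (suc k′)) (m<n⇒m%n≡m r<k)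

κsqExponent-≤-next : 1 ≤ k → ∀ u r → r < k →
                     κsqExponent k (suc (r + u * k)) ≤ κsqExponent k (suc (suc r + u * k))
κsqExponent-≤-next {k} 1≤k u r r<k with m≤n⇒m<n∨m≡n r<k
... | inj₁ 1+r<k = begin
  κsqExponent k (suc (r + u * k))     ≡⟨ κsqExponent-1+r+u*k 1≤k u r r<k ⟩
  2 * u + remainderExponent r         ≤⟨ +-monoʳ-≤ (2 * u) (remainderExponent≤2 r) ⟩
  2 * u + 2                           ≡⟨ κsqExponent-1+r+u*k 1≤k u (suc r) 1+r<k ⟨
  κsqExponent k (suc (suc r + u * k)) ∎
  where open ≤-Reasoning
... | inj₂ refl = begin
  κsqExponent k (suc (r + u * k))     ≡⟨ κsqExponent-1+r+u*k 1≤k u r r<k ⟩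
  2 * u + remainderExponent r         ≤⟨ +-monoʳ-≤ (2 * u) (remainderExponent≤2 r) ⟩
  2 * u + 2                           ≤⟨ n≤1+n _ ⟩
  suc (2 * u + 2)                     ≡⟨ 1+[2u+2]≡2[1+u]+1 u ⟩
  2 * suc u + 1                       ≡⟨ κsqExponent-1+r+u*k 1≤k (suc u) 0 (s≤s z≤n) ⟨
  κsqExponent k (suc (suc u * k))     ∎
  where
  open ≤-Reasoning
  1+[2u+2]≡2[1+u]+1 : ∀ u → suc (2 * u + 2) ≡ 2 * suc u + 1
  1+[2u+2]≡2[1+u]+1 = solve-∀

κsqExponent-≤-suc : 1 ≤ k → ∀ e → κsqExponent k e ≤ κsqExponent k (suc e)
κsqExponent-≤-suc 1≤k zero = z≤n
κsqExponent-≤-suc {suc k′} 1≤k (suc e) =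
  subst (λ x → κsqExponent (suc k′) (suc x) ≤ κsqExponent (suc k′) (suc (suc x)))
        (sym (m≡m%n+[m/n]*n e (suc k′)))
        (κsqExponent-≤-next 1≤k (e / suc k′) (e % suc k′) (m%n<n e (suc k′)))

κsqExponent-mono : ∀ {e f} → 1 ≤ k → e ≤ f → κsqExponent k e ≤ κsqExponent k f
κsqExponent-mono {k} 1≤k e≤f = go (≤⇒≤′ e≤f)
  where
  go : ∀ {e f} → e ≤′ f → κsqExponent k e ≤ κsqExponent k f
  go ≤′-refl                     = ≤-refl
  go {f = suc f} (≤′-step e≤′f) = ≤-trans (go e≤′f) (κsqExponent-≤-suc 1≤k f)

κsqExponent-+k : 2 ≤ k → ∀ e → κsqExponent k (e + k) ≡ κsqExponent k e + 2
κsqExponent-+k {suc k′} 2≤k@(s≤s (s≤s _)) zero =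
  trans (cong (λ x → κsqExponent (suc k′) (suc x)) (sym (+-identityʳ k′)))
        (κsqExponent-1+r+u*k (<⇒≤ 2≤k) 0 k′ ≤-refl)
κsqExponent-+k {suc k′} 2≤k (suc e) = begin
  κsqExponent K (suc (e + K))         ≡⟨ cong (λ x → κsqExponent K (suc (x + K))) (m≡m%n+[m/n]*n e K) ⟩
  κsqExponent K (suc (r + u * K + K)) ≡⟨ cong (λ x → κsqExponent K (suc x)) (x+y+z≡x+[z+y] r (u * K) K) ⟩
  κsqExponent K (suc (r + suc u * K)) ≡⟨ κsqExponent-1+r+u*k (<⇒≤ 2≤k) (suc u) r (m%n<n e K) ⟩
  2 * suc u + remainderExponent r     ≡⟨ 2[1+u]+x≡2u+x+2 u (remainderExponent r) ⟩
  2 * u + remainderExponent r + 2     ∎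
  where
  open ≡-Reasoning
  K = suc k′
  r = e % K
  u = e / K
  x+y+z≡x+[z+y] : ∀ x y z → x + y + z ≡ x + (z + y)
  x+y+z≡x+[z+y] = solve-∀
  2[1+u]+x≡2u+x+2 : ∀ u x → 2 * suc u + x ≡ 2 * u + x + 2
  2[1+u]+x≡2u+x+2 = solve-∀

κsqExponent-+multiple : 2 ≤ k → ∀ g e → κsqExponent k (e + g * k) ≡ κsqExponent k e + 2 * g
κsqExponent-+multiple {k} 2≤k zero e =
  trans (cong (κsqExponent k) (+-identityʳ e)) (sym (+-identityʳ _))
κsqExponent-+multiple {k} 2≤k (suc g) e = begin
  κsqExponent k (e + (k + g * k)) ≡⟨ cong (κsqExponent k) (+-assoc e k (g * k)) ⟨
  κsqExponent k (e + k + g * k)   ≡⟨ κsqExponent-+multiple 2≤k g (e + k) ⟩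
  κsqExponent k (e + k) + 2 * g   ≡⟨ cong (_+ 2 * g) (κsqExponent-+k 2≤k e) ⟩
  κsqExponent k e + 2 + 2 * g     ≡⟨ x+2+2g≡x+2[1+g] (κsqExponent k e) g ⟩
  κsqExponent k e + 2 * suc g     ∎
  where
  open ≡-Reasoning
  x+2+2g≡x+2[1+g] : ∀ x g → x + 2 + 2 * g ≡ x + 2 * suc g
  x+2+2g≡x+2[1+g] = solve-∀

κsqExponent-+-≤ : 2 ≤ k → b ≤ k * g → ∀ c → κsqExponent k (b + c) ≤ κsqExponent k c + 2 * g
κsqExponent-+-≤ {k} {b} {g} 2≤k b≤kg c = begin
  κsqExponent k (b + c)     ≤⟨ κsqExponent-mono (<⇒≤ 2≤k) b+c≤c+gk ⟩
  κsqExponent k (c + g * k) ≡⟨ κsqExponent-+multiple 2≤k g c ⟩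
  κsqExponent k c + 2 * g   ∎
  where
  open ≤-Reasoning
  b+c≤c+gk : b + c ≤ c + g * k
  b+c≤c+gk = subst₂ _≤_ (+-comm c b) (cong (_+_ c) (*-comm k g)) (+-monoʳ-≤ c b≤kg)

^-double : ∀ m n → m ^ (2 * n) ≡ m ^ n * m ^ n
^-double m n = trans (^-distribˡ-+-* m n (1 * n)) (cong (λ x → m ^ n * m ^ x) (*-identityˡ n))

κsqLocal-cross-≤ : 2 ≤ k → b ≤ k * g → ∀ P .{{_ : NonZero P}} c →
                   κsqNumerator k c * P ^ κsqExponent k (b + c) ≤
                   (k * P ^ g) * (k * P ^ g) * κsqNumerator k (b + c) * P ^ κsqExponent k c
κsqLocal-cross-≤ {k} {b} {g} 2≤k b≤kg P c = begin
  Nc * P ^ sa                             ≤⟨ *-mono-≤ Nc≤k*k*Na (^-monoʳ-≤ P (κsqExponent-+-≤ 2≤k b≤kg c)) ⟩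
  k * k * Na * P ^ (sc + 2 * g)           ≡⟨ cong (k * k * Na *_) (^-distribˡ-+-* P sc (2 * g)) ⟩
  k * k * Na * (P ^ sc * P ^ (2 * g))     ≡⟨ cong (λ x → k * k * Na * (P ^ sc * x)) (^-double P g) ⟩
  k * k * Na * (P ^ sc * (P ^ g * P ^ g)) ≡⟨ rearrange k Na (P ^ sc) (P ^ g) ⟩
  (k * P ^ g) * (k * P ^ g) * Na * P ^ sc ∎
  where
  open ≤-Reasoning
  Nc = κsqNumerator k c
  Na = κsqNumerator k (b + c)
  sc = κsqExponent k c
  sa = κsqExponent k (b + c)
  1≤k = <⇒≤ 2≤k
  Nc≤k*k*Na : Nc ≤ k * k * Na
  Nc≤k*k*Na = ≤-trans (κsqNumerator≤k*k 1≤k c)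
                      (m≤m*n (k * k) Na {{>-nonZero (1≤κsqNumerator 1≤k (b + c))}})
  rearrange : ∀ k n x y → k * k * n * (x * (y * y)) ≡ (k * y) * (k * y) * n * x
  rearrange = solve-∀

κsqLocal-≤ : 2 ≤ k → b ≤ k * g → ∀ p c →
             κsqLocal k (suc p) c ≤ℚ
             (+ ((k * suc p ^ g) * (k * suc p ^ g)) /ℚ 1) *ℚ κsqLocal k (suc p) (b + c)
κsqLocal-≤ {k} {b} {g} 2≤k b≤kg p c = begin
  κsqLocal k P c                                  ≡⟨ κsqLocal≡ k p c ⟩
  (+ Nc /ℚ P ^ sc) {{P^sc≢0}}                     ≤⟨ fraction-≤ Nc (P ^ sc) (u * u * Na) (1 * P ^ sa)
                                                       {{P^sc≢0}} {{1*P^sa≢0}} cross ⟩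
  (+ (u * u * Na) /ℚ (1 * P ^ sa)) {{1*P^sa≢0}}   ≡⟨ fraction-* (u * u) 1 Na (P ^ sa) {{_}} {{P^sa≢0}} ⟨
  (+ (u * u) /ℚ 1) *ℚ (+ Na /ℚ P ^ sa) {{P^sa≢0}} ≡⟨ cong ((+ (u * u) /ℚ 1) *ℚ_) (κsqLocal≡ k p (b + c)) ⟨
  (+ (u * u) /ℚ 1) *ℚ κsqLocal k P (b + c)        ∎
  where
  open ℚ.≤-Reasoning
  P = suc p
  u = k * P ^ g
  Nc = κsqNumerator k c
  Na = κsqNumerator k (b + c)
  sc = κsqExponent k c
  sa = κsqExponent k (b + c)
  P^sc≢0 = m^n≢0 P sc
  P^sa≢0 = m^n≢0 P sa
  1*P^sa≢0 = m*n≢0 1 (P ^ sa) {{_}} {{P^sa≢0}}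
  cross : Nc * (1 * P ^ sa) ≤ u * u * Na * P ^ sc
  cross = subst (_≤ u * u * Na * P ^ sc) (cong (Nc *_) (sym (*-identityˡ (P ^ sa))))
                (κsqLocal-cross-≤ 2≤k b≤kg P c)

-- κ² as a product over prime divisors

primeDivisor? : ∀ n → Decidable (λ p → Prime p × p ∣ n)
primeDivisor? n p = prime? p ×-dec p ∣? n

κsqFactor : (k n p : ℕ) → ℚ
κsqFactor k n p = κsqLocal k p (valuation p n)

κsqFactor-nonNeg : ∀ k n p → NonNegative (κsqFactor k n p)
κsqFactor-nonNeg k n zero    = _
κsqFactor-nonNeg k n (suc p) = subst NonNegative (sym (κsqLocal≡ k p v))
  (ℚ.normalize-nonNeg (κsqNumerator k v) (suc p ^ κsqExponent k v) {{m^n≢0 (suc p) (κsqExponent k v)}})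
  where v = val (suc p) n

κsqFactor-∤ : ∀ k {n p} → ¬ p ∣ n → κsqFactor k n p ≡ 1ℚ
κsqFactor-∤ k {p = zero}  _   = refl
κsqFactor-∤ k {p = suc p} p∤n = cong (κsqLocal k (suc p)) (val-none p∤n)

κsqFactor-quotient-≤ : 2 ≤ k → Prime p → ∀ Q d M → .{{_ : NonZero (Q * d)}} → .{{_ : NonZero M}} →
                       d ∣ M ^ k →
                       κsqFactor k Q p ≤ℚ
                       (+ ((k * p ^ valuation p M) * (k * p ^ valuation p M)) /ℚ 1) *ℚ κsqFactor k (Q * d) p
κsqFactor-quotient-≤ {p = zero} _ ()
κsqFactor-quotient-≤ {k} {suc p} 2≤k pp Q d M d∣M^k =
  subst (λ v → κsqLocal k P (val P Q) ≤ℚ (+ (u * u) /ℚ 1) *ℚ κsqLocal k P v)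
        (trans (+-comm (val P d) (val P Q)) (sym (val-* pp Q d {{m*n≢0⇒m≢0 Q}} {{m*n≢0⇒n≢0 Q}})))
        (κsqLocal-≤ 2≤k vd≤k*vM p (val P Q))
  where
  P = suc p
  u = k * P ^ val P M
  vd≤k*vM : val P d ≤ k * val P M
  vd≤k*vM = ≤-trans (val-mono-∣ pp {{m^n≢0 M k}} d∣M^k) (≤-reflexive (val-^ pp M k))

κsq≡prodℚ : ∀ k n → κsq k n ≡ prodℚ (primeDivisors n) (κsqFactor k n)
κsq≡prodℚ k n = foldr-cong same-factor refl (primeDivisors n)
  where
  same-factor : ∀ p acc → _ ≡ κsqFactor k n p *ℚ acc
  same-factor zero    acc = refl
  same-factor (suc p) acc = refl

κsq-nonNeg : ∀ k n → NonNegative (κsq k n)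
κsq-nonNeg k n = subst NonNegative (sym (κsq≡prodℚ k n))
                       (prodℚ-nonNeg {κsqFactor k n} (primeDivisors n) (κsqFactor-nonNeg k n))

κsq≡prodℚ-multiple : ∀ k {n m} .{{_ : NonZero m}} → n ∣ m →
                     κsq k n ≡ prodℚ (primeDivisors m) (κsqFactor k n)
κsq≡prodℚ-multiple k {n} {m} n∣m = begin
  κsq k n
    ≡⟨ κsq≡prodℚ k n ⟩
  prodℚ (filter (primeDivisor? n) (upTo (suc n))) f
    ≡⟨ cong (λ ps → prodℚ ps f) (filter-upTo-stable (primeDivisor? n) (s≤s (∣⇒≤ n∣m)) too-large) ⟨
  prodℚ (filter (primeDivisor? n) (upTo (suc m))) f
    ≡⟨ prodℚ-filter-× prime? (_∣? n) trivial-outside-n (upTo (suc m)) ⟩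
  prodℚ (filter prime? (upTo (suc m))) f
    ≡⟨ prodℚ-filter-× prime? (_∣? m) trivial-outside-m (upTo (suc m)) ⟨
  prodℚ (filter (primeDivisor? m) (upTo (suc m))) f ∎
  where
  open ≡-Reasoning
  f = κsqFactor k n
  instance
    n≢0 : NonZero n
    n≢0 = ≢-nonZero (λ n≡0 → ≢-nonZero⁻¹ m (0∣⇒≡0 (subst (_∣ m) n≡0 n∣m)))
  too-large : ∀ {i} → suc n ≤ i → i < suc m → ¬ (Prime i × i ∣ n)
  too-large n<i _ (_ , i∣n) = <⇒≱ n<i (∣⇒≤ i∣n)
  trivial-outside-n : ∀ x → Prime x → ¬ x ∣ n → f x ≡ 1ℚ
  trivial-outside-n _ _ = κsqFactor-∤ k
  trivial-outside-m : ∀ x → Prime x → ¬ x ∣ m → f x ≡ 1ℚ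
  trivial-outside-m _ _ x∤m = κsqFactor-∤ k (x∤m ∘ (λ x∣n → ∣-trans x∣n n∣m))

primeDivisors-prime : ∀ n → All Prime (primeDivisors n)
primeDivisors-prime n = All.map proj₁ (all-filter (primeDivisor? n) (upTo (suc n)))

primeDivisors-unique : ∀ n → Unique (primeDivisors n)
primeDivisors-unique n = Unique.filter⁺ (primeDivisor? n) (Unique.upTo⁺ (suc n))

κsq-quotient-≤ : 2 ≤ k → ∀ Q d M → .{{_ : NonZero (Q * d)}} → .{{_ : NonZero M}} → d ∣ M ^ k →
                 let U = product (map (λ p → k * p ^ valuation p M) (primeDivisors (Q * d))) in
                 κsq k Q ≤ℚ (+ (U * U) /ℚ 1) *ℚ κsq k (Q * d)
κsq-quotient-≤ {k} 2≤k Q d M d∣M^k = begin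
  κsq k Q
    ≡⟨ κsq≡prodℚ-multiple k (m∣m*n {Q} d) ⟩
  prodℚ ps (κsqFactor k Q)
    ≤⟨ prodℚ-mono (κsqFactor-nonNeg k Q) (All.map local (primeDivisors-prime (Q * d))) ⟩
  prodℚ ps (λ p → (+ (u p * u p) /ℚ 1) *ℚ κsqFactor k (Q * d) p)
    ≡⟨ prodℚ-scale (λ p → u p * u p) (κsqFactor k (Q * d)) ps ⟩
  (+ product (map (λ p → u p * u p) ps) /ℚ 1) *ℚ prodℚ ps (κsqFactor k (Q * d))
    ≡⟨ cong₂ (λ n x → (+ n /ℚ 1) *ℚ x) (product-map-* u u ps) (sym (κsq≡prodℚ k (Q * d))) ⟩
  (+ (product (map u ps) * product (map u ps)) /ℚ 1) *ℚ κsq k (Q * d) ∎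
  where
  open ℚ.≤-Reasoning
  ps = primeDivisors (Q * d)
  u : ℕ → ℕ
  u p = k * p ^ valuation p M
  local : ∀ {p} → Prime p → κsqFactor k Q p ≤ℚ (+ (u p * u p) /ℚ 1) *ℚ κsqFactor k (Q * d) p
  local pp = κsqFactor-quotient-≤ 2≤k pp Q d M d∣M^k

primePowerPart-scaled-≤ : ∀ k q M → .{{_ : NonZero M}} →
                          product (map (λ p → k * p ^ valuation p M) (primeDivisors q)) ≤ k ^ ω q * M
primePowerPart-scaled-≤ k q M = begin
  product (map (λ p → k * p ^ valuation p M) ps) ≡⟨ product-map-* (λ _ → k) (λ p → p ^ valuation p M) ps ⟩
  product (map (λ _ → k) ps) * primePowerPart ps M ≡⟨ cong (_* primePowerPart ps M) (product-map-const k ps) ⟩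
  k ^ ω q * primePowerPart ps M                    ≤⟨ *-monoʳ-≤ (k ^ ω q) (∣⇒≤ M-part∣M) ⟩
  k ^ ω q * M                                      ∎
  where
  open ≤-Reasoning
  ps = primeDivisors q
  M-part∣M = primePowerPart-∣ (primeDivisors-prime q) (primeDivisors-unique q) M

^-distribʳ-* : ∀ m n o → (m * n) ^ o ≡ m ^ o * n ^ o
^-distribʳ-* m n zero    = refl
^-distribʳ-* m n (suc o) = trans (cong (m * n *_) (^-distribʳ-* m n o)) (ℕ*.interchange m n (m ^ o) (n ^ o))

^-monoʳ-∣ : ∀ m {n o} → n ≤ o → m ^ n ∣ m ^ o
^-monoʳ-∣ m {n} {o} n≤o = divides (m ^ (o ∸ n)) (begin
  m ^ o               ≡⟨ cong (m ^_) (m∸n+n≡m n≤o) ⟨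
  m ^ (o ∸ n + n)     ≡⟨ ^-distribˡ-+-* m (o ∸ n) n ⟩
  m ^ (o ∸ n) * m ^ n ∎)
  where open ≡-Reasoning

prodFin-∣ : ∀ n {f g : Fin n → ℕ} → (∀ i → f i ∣ g i) → prodFin n f ∣ prodFin n g
prodFin-∣ zero    f∣g = ∣-refl
prodFin-∣ (suc n) f∣g = *-pres-∣ (f∣g Fin.zero) (prodFin-∣ n (f∣g ∘ Fin.suc))

prodFin-^ : ∀ n (f : Fin n → ℕ) o → prodFin n f ^ o ≡ prodFin n (λ i → f i ^ o)
prodFin-^ zero    f o = ^-zeroˡ o
prodFin-^ (suc n) f o =
  trans (^-distribʳ-* (f Fin.zero) _ o) (cong (f Fin.zero ^ o *_) (prodFin-^ n (f ∘ Fin.suc) o))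

prodFin-∣-powers : ∀ n (f h : Fin n → ℕ) → prodFin n f ∣ prodFin n (λ i → f i ^ suc (h i))
prodFin-∣-powers n f h = prodFin-∣ n (λ i → m∣m*n (f i ^ h i))

prodFin-powers-∣-^ : ∀ n (f h : Fin n → ℕ) m → (∀ i → h i < m) →
                     prodFin n (λ i → f i ^ suc (h i)) ∣ prodFin n f ^ m
prodFin-powers-∣-^ n f h m h<m =
  subst (_ ∣_) (sym (prodFin-^ n f m)) (prodFin-∣ n (λ i → ^-monoʳ-∣ (f i) (h<m i)))

lemma2p1 : (k : ℕ) → 2 ≤ k → (q : ℕ) → 1 ≤ q → (d : ℕ) → (d∣q : d ∣ q) →
  (e₀ : ℕ) → (ds : Fin k → ℕ) →
  e₀ * prodFin k (λ i → ds i ^ suc (toℕ i)) ≡ d →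
  (∀ i j → toℕ i < k ∸ 1 → toℕ j < k ∸ 1 → i ≢ j → Coprime (ds i) (ds j)) →
  (∀ i → toℕ i < k ∸ 1 → Squarefree (ds i)) →
  κsq k (quotient d∣q)
    ≤ℚ (((+ ((k ^ (4 * ω q)) * (k ^ (4 * ω q)))) /ℚ 1) *ℚ κsq k q)
        *ℚ ((+ ((e₀ * prodFin k ds) * (e₀ * prodFin k ds))) /ℚ 1)
lemma2p1 k@(suc k′) 2≤k .(Q * d) 1≤q d (divides Q refl) e₀ ds d≡ _ _ = begin
  κsq k Q                      ≤⟨ κsq-quotient-≤ 2≤k Q d M d∣M^k ⟩
  (+ (U * U) /ℚ 1) *ℚ κsq k q  ≤⟨ fraction-square-scale-≤ U K4 M (κsq k q) {{κsq-nonNeg k q}} U≤K4*M ⟩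
  ((+ (K4 * K4) /ℚ 1) *ℚ κsq k q) *ℚ (+ (M * M) /ℚ 1) ∎
  where
  open ℚ.≤-Reasoning
  q = Q * d
  M = e₀ * prodFin k ds
  K4 = k ^ (4 * ω q)
  U = product (map (λ p → k * p ^ valuation p M) (primeDivisors q))
  M∣d : M ∣ d
  M∣d = subst (M ∣_) d≡ (*-monoʳ-∣ e₀ (prodFin-∣-powers k ds toℕ))
  d∣M^k : d ∣ M ^ k
  d∣M^k = subst₂ _∣_ d≡ (sym (^-distribʳ-* e₀ (prodFin k ds) k))
                 (*-pres-∣ (m∣m*n {e₀} (e₀ ^ k′)) (prodFin-powers-∣-^ k ds toℕ k toℕ<n))
  instance
    q≢0 : NonZero q
    q≢0 = >-nonZero 1≤q
    M≢0 : NonZero M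
    M≢0 = ≢-nonZero (λ M≡0 → ≢-nonZero⁻¹ d {{m*n≢0⇒n≢0 Q}} (0∣⇒≡0 (subst (_∣ d) M≡0 M∣d)))
  U≤K4*M : U ≤ K4 * M
  U≤K4*M = ≤-trans (primePowerPart-scaled-≤ k q M) (*-monoˡ-≤ M (^-monoʳ-≤ k (m≤n*m (ω q) 4)))
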